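{- Let $G=(V,E)$ be a finite undirected graph and let $L$ be any ordering (probing list) of the set of all unordered pairs of distinct nodes of $V$. Let $u\in V$ and let $L_u$ be the list obtained from $L$ by removing all pairs containing $u$. Then the symmetric difference $M(L)\oplus M(L_u)$ is an alternating path (possibly with no edges), and it contains at least one edge if and only if $u$ is matched in $M(L)$.
   Context: Probing $G$ with a list $L$ of unordered pairs means: initially all nodes are unmatched; the pairs are considered in the order of $L$, and when $\{a,b\}$ is considered, if both $a,b$ are currently unmatched and $\{a,b\}\in E$, then $a$ and $b$ become matched to each other; otherwise nothing happens. $M(L)$ denotes the resulting matching. A node is matched in $L$ if it is covered by $M(L)$. An alternating path here is a path whose edges alternate between $M(L)$ and $M(L_u)$. -}

module Defs where

open import Data.Nat using (ℕ)
open import Data.Fin using (Fin; _≟_)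
open import Data.Bool using (Bool; true; false; _∧_; _∨_; not; if_then_else_)
open import Data.List using (List; []; _∷_)
open import Data.List.Membership.Propositional using (_∈_)
open import Data.List.Relation.Unary.Any using (Any)
open import Data.List.Relation.Unary.AllPairs using (AllPairs)
open import Data.Product using (_×_; _,_; proj₁; proj₂; Σ; ∃)
open import Data.Sum using (_⊎_)
open import Data.Empty using (⊥)
open import Data.Unit using (⊤)
open import Relation.Nullary using (¬_; does)
open import Relation.Binary.PropositionalEquality using (_≡_; _≢_)

record Graph (n : ℕ) : Set where
  field
    adj     : Fin n → Fin n → Bool
    adj-sym : ∀ a b → adj a b ≡ adj b a
    adj-irr : ∀ a → adj a a ≡ false

open Graph public

-- A pair {a,b} is represented by an ordered pair (a , b).
Pair : ℕ → Set
Pair n = Fin n × Fin n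

SamePair : ∀ {n} → Pair n → Pair n → Set
SamePair (a , b) (c , d) = ((a ≡ c) × (b ≡ d)) ⊎ ((a ≡ d) × (b ≡ c))

IsProbingList : ∀ {n} → List (Pair n) → Set
IsProbingList {n} L =
  (∀ {p} → p ∈ L → proj₁ p ≢ proj₂ p)
  × (∀ (a b : Fin n) → a ≢ b → Any (SamePair (a , b)) L)
  × AllPairs (λ p q → ¬ SamePair p q) L

-- A matching is stored as the list of its matched pairs.
_==_ : ∀ {n} → Fin n → Fin n → Bool
a == b = does (a ≟ b)

isCovered : ∀ {n} → Fin n → List (Pair n) → Bool
isCovered v [] = false
isCovered v ((a , b) ∷ M) = (a == v) ∨ (b == v) ∨ isCovered v M

probeStep : ∀ {n} → Graph n → List (Pair n) → Pair n → List (Pair n)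
probeStep G M (a , b) =
  if not (isCovered a M) ∧ not (isCovered b M) ∧ adj G a b
  then (a , b) ∷ M else M

probeFrom : ∀ {n} → Graph n → List (Pair n) → List (Pair n) → List (Pair n)
probeFrom G M [] = M
probeFrom G M (p ∷ L) = probeFrom G (probeStep G M p) L

probe : ∀ {n} → Graph n → List (Pair n) → List (Pair n)
probe G L = probeFrom G [] L

removeNode : ∀ {n} → Fin n → List (Pair n) → List (Pair n)
removeNode u [] = []
removeNode u ((a , b) ∷ L) =
  if (a == u) ∨ (b == u) then removeNode u L else (a , b) ∷ removeNode u L

InM : ∀ {n} → List (Pair n) → Fin n → Fin n → Set
InM M x y = ((x , y) ∈ M) ⊎ ((y , x) ∈ M)

Matched : ∀ {n} → Fin n → List (Pair n) → Set
Matched v M = Any (λ p → (proj₁ p ≡ v) ⊎ (proj₂ p ≡ v)) M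

SymDiff : ∀ {n} → List (Pair n) → List (Pair n) → Fin n → Fin n → Set
SymDiff M₁ M₂ x y = (InM M₁ x y × ¬ InM M₂ x y) ⊎ (InM M₂ x y × ¬ InM M₁ x y)

Consecutive : ∀ {A : Set} → List A → A → A → Set
Consecutive (x ∷ y ∷ rest) a b = ((a ≡ x) × (b ≡ y)) ⊎ Consecutive (y ∷ rest) a b
Consecutive _ a b = ⊥

Alternating : ∀ {n} → List (Pair n) → List (Pair n) → List (Fin n) → Set
Alternating M₁ M₂ (x ∷ y ∷ z ∷ rest) =
  ((InM M₁ x y × InM M₂ y z) ⊎ (InM M₂ x y × InM M₁ y z))
  × Alternating M₁ M₂ (y ∷ z ∷ rest)
Alternating M₁ M₂ _ = ⊤

-- Probe L and L_u side by side; pairs containing u are probed only on the L side.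
-- Until u gets matched the two matchings coincide. Afterwards their symmetric
-- difference is an alternating path from u to a front node e, where e is matched
-- on one side and free on the other while all nodes other than e and u are
-- covered alike on both sides. A pair not containing e is therefore accepted or
-- rejected on both sides alike and only touches nodes off the path; a pair {e,b}
-- is rejected on the side where e is matched and, if accepted on the other side,
-- extends the path by the edge eb, b becoming the new front.

module Submission where

open import Defs
open import Data.Nat using (ℕ)
open import Data.Fin using (Fin; _≟_)
open import Data.Bool using (Bool; true; false; _∧_; _∨_; not; if_then_else_)
open import Data.Bool.Properties using (∨-zeroʳ; ∧-zeroʳ; ∧-conicalˡ; ∧-conicalʳ; not-injective)
open import Data.Empty using (⊥-elim)
open import Data.Unit using (tt)
open import Data.List using (List; []; _∷_)
open import Data.List.Membership.Propositional using (_∈_; _∉_)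
open import Data.List.Relation.Unary.Any as Any using (here; there)
open import Data.List.Relation.Unary.All using ([]; _∷_)
open import Data.List.Relation.Unary.All.Properties.Core using (¬Any⇒All¬)
open import Data.List.Relation.Unary.AllPairs using ([]; _∷_)
open import Data.List.Relation.Unary.Unique.Propositional using (Unique)
open import Data.Product as Product using (_×_; Σ; ∃; ∃-syntax; _,_; proj₁; proj₂)
open import Data.Sum as Sum using (_⊎_; inj₁; inj₂)
open import Data.Sum.Function.Propositional using (_⊎-⇔_)
open import Function using (_∘_; id)
open import Function.Bundles using (_⇔_; mk⇔; Equivalence)
open import Function.Related.Propositional using (module EquationalReasoning)
open import Function.Properties.Equivalence using () renaming (refl to ⇔-refl; sym to ⇔-sym; trans to ⇔-trans)
open import Relation.Nullary using (¬_; yes; no; contradiction)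
open import Relation.Nullary.Decidable using (dec-true; dec-false)
open import Relation.Binary.PropositionalEquality using (_≡_; _≢_; refl; sym; trans; cong; cong₂)

open Equivalence using (to; from)

private variable
  n : ℕ
  a b e v w x y : Fin n
  p q : Pair n
  M M₁ M₂ M₁′ M₂′ : List (Pair n)
  rest : List (Fin n)

==-refl : (a : Fin n) → (a == a) ≡ true
==-refl a = dec-true (a ≟ a) refl

≢⇒==-false : a ≢ b → (a == b) ≡ false
≢⇒==-false {a = a} {b} = dec-false (a ≟ b)

Matched⇒isCovered : Matched v M → isCovered v M ≡ true
Matched⇒isCovered {M = (a , b) ∷ M} (here (inj₁ refl)) rewrite ==-refl a = refl
Matched⇒isCovered {M = (a , b) ∷ M} (here (inj₂ refl)) rewrite ==-refl b = ∨-zeroʳ (a == b)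
Matched⇒isCovered {v = v} {M = (a , b) ∷ M} (there m)
  rewrite Matched⇒isCovered m | ∨-zeroʳ (b == v) = ∨-zeroʳ (a == v)

isCovered⇒Matched : ∀ M → isCovered v M ≡ true → Matched v M
isCovered⇒Matched {v = v} ((a , b) ∷ M) c with a ≟ v | b ≟ v
... | yes a≡v | _       = here (inj₁ a≡v)
... | no _    | yes b≡v = here (inj₂ b≡v)
... | no _    | no _    = there (isCovered⇒Matched M c)

isCovered-∷ : a ≢ v → b ≢ v → isCovered v ((a , b) ∷ M) ≡ isCovered v M
isCovered-∷ a≢v b≢v rewrite ≢⇒==-false a≢v | ≢⇒==-false b≢v = refl

InM-sym : InM M x y → InM M y x
InM-sym = Sum.swap

InM-there : InM M x y → InM (q ∷ M) x y
InM-there = Sum.map there there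

InM⇒isCovered : InM M x y → isCovered x M ≡ true
InM⇒isCovered (inj₁ xy∈M) = Matched⇒isCovered (Any.map (λ { refl → inj₁ refl }) xy∈M)
InM⇒isCovered (inj₂ yx∈M) = Matched⇒isCovered (Any.map (λ { refl → inj₂ refl }) yx∈M)

free⇒¬InM : isCovered x M ≡ false → ¬ InM M x y
free⇒¬InM free xy = contradiction (trans (sym (InM⇒isCovered xy)) free) λ ()

Joins : Pair n → Fin n → Fin n → Set
Joins q x y = (x , y) ≡ q ⊎ (y , x) ≡ q

Joins-sym : Joins q x y → Joins q y x
Joins-sym = Sum.swap

Joins-unique : Joins q a b → Joins q x y → (x ≡ a × y ≡ b) ⊎ (x ≡ b × y ≡ a)
Joins-unique (inj₁ refl) (inj₁ refl) = inj₁ (refl , refl)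
Joins-unique (inj₁ refl) (inj₂ refl) = inj₂ (refl , refl)
Joins-unique (inj₂ refl) (inj₁ refl) = inj₂ (refl , refl)
Joins-unique (inj₂ refl) (inj₂ refl) = inj₁ (refl , refl)

Joins⇒endpoint : Joins (a , b) x y → x ≡ a ⊎ x ≡ b
Joins⇒endpoint (inj₁ refl) = inj₁ refl
Joins⇒endpoint (inj₂ refl) = inj₂ refl

Joins-isCovered : Joins q a b → v ≢ a → v ≢ b → isCovered v (q ∷ M) ≡ isCovered v M
Joins-isCovered {M = M} (inj₁ refl) v≢a v≢b = isCovered-∷ {M = M} (v≢a ∘ sym) (v≢b ∘ sym)
Joins-isCovered {M = M} (inj₂ refl) v≢a v≢b = isCovered-∷ {M = M} (v≢b ∘ sym) (v≢a ∘ sym)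

Joins-free⇒¬InM : Joins q a b → isCovered a M ≡ false → Joins q x y → ¬ InM M x y
Joins-free⇒¬InM ab a-free xy with Joins-unique ab xy
... | inj₁ (refl , refl) = free⇒¬InM a-free
... | inj₂ (refl , refl) = free⇒¬InM a-free ∘ InM-sym

InM-here : Joins q x y → InM (q ∷ M) x y
InM-here = Sum.map here here

InM-∷⁻ : InM (q ∷ M) x y → Joins q x y ⊎ InM M x y
InM-∷⁻ (inj₁ (here xy≡q))  = inj₁ (inj₁ xy≡q)
InM-∷⁻ (inj₁ (there xy∈M)) = inj₂ (inj₁ xy∈M)
InM-∷⁻ (inj₂ (here yx≡q))  = inj₁ (inj₂ yx≡q)
InM-∷⁻ (inj₂ (there yx∈M)) = inj₂ (inj₂ yx∈M)

SymDiff-comm : SymDiff M₁ M₂ x y ⇔ SymDiff M₂ M₁ x y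
SymDiff-comm = mk⇔ Sum.swap Sum.swap

SymDiff-self : ¬ SymDiff M M x y
SymDiff-self (inj₁ (in₁ , ∉₂)) = ∉₂ in₁
SymDiff-self (inj₂ (in₂ , ∉₁)) = ∉₁ in₂

SymDiff-∷ : (∀ {x y} → Joins q x y → ¬ InM M₁ x y) →
            SymDiff (q ∷ M₂) M₁ x y ⇔ (Joins q x y ⊎ SymDiff M₂ M₁ x y)
SymDiff-∷ {q = q} {M₁ = M₁} {M₂} {x} {y} q∉M₁ = mk⇔ ⇒ ⇐
  where
  ⇒ : SymDiff (q ∷ M₂) M₁ x y → Joins q x y ⊎ SymDiff M₂ M₁ x y
  ⇒ (inj₁ (in₂ , ∉₁)) = Sum.map₂ (λ in₂′ → inj₁ (in₂′ , ∉₁)) (InM-∷⁻ in₂)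
  ⇒ (inj₂ (in₁ , ∉₂)) = inj₂ (inj₂ (in₁ , ∉₂ ∘ InM-there))
  ⇐ : Joins q x y ⊎ SymDiff M₂ M₁ x y → SymDiff (q ∷ M₂) M₁ x y
  ⇐ (inj₁ xy) = inj₁ (InM-here xy , q∉M₁ xy)
  ⇐ (inj₂ (inj₁ (in₂ , ∉₁))) = inj₁ (InM-there in₂ , ∉₁)
  ⇐ (inj₂ (inj₂ (in₁ , ∉₂))) =
    inj₂ (in₁ , Sum.[ (λ xy → q∉M₁ xy in₁) , ∉₂ ] ∘ InM-∷⁻)

SymDiff-∷-∷ : (∀ {x y} → Joins q x y → ¬ SymDiff M₁ M₂ x y) →
              SymDiff (q ∷ M₁) (q ∷ M₂) x y ⇔ SymDiff M₁ M₂ x y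
SymDiff-∷-∷ {q = q} {M₁ = M₁} {M₂} {x} {y} q∉diff = mk⇔ ⇒ ⇐
  where
  drop : ∀ {A B} → InM (q ∷ A) x y → ¬ InM (q ∷ B) x y → InM A x y × ¬ InM B x y
  drop inA ∉B = Sum.[ (λ xy → contradiction (InM-here xy) ∉B) , id ] (InM-∷⁻ inA) , ∉B ∘ InM-there
  ⇒ : SymDiff (q ∷ M₁) (q ∷ M₂) x y → SymDiff M₁ M₂ x y
  ⇒ = Sum.map (λ (in₁ , ∉₂) → drop in₁ ∉₂) (λ (in₂ , ∉₁) → drop in₂ ∉₁)
  keep : ∀ {A} → SymDiff M₁ M₂ x y → ¬ InM A x y → ¬ InM (q ∷ A) x y
  keep d ∉A = Sum.[ (λ xy → q∉diff xy d) , ∉A ] ∘ InM-∷⁻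
  ⇐ : SymDiff M₁ M₂ x y → SymDiff (q ∷ M₁) (q ∷ M₂) x y
  ⇐ d@(inj₁ (in₁ , ∉₂)) = inj₁ (InM-there in₁ , keep d ∉₂)
  ⇐ d@(inj₂ (in₂ , ∉₁)) = inj₂ (InM-there in₂ , keep d ∉₁)

PathEdge : List (Fin n) → Fin n → Fin n → Set
PathEdge vs x y = Consecutive vs x y ⊎ Consecutive vs y x

Consecutive⇒∈ : ∀ {A : Set} {vs : List A} {x y} → Consecutive vs x y → x ∈ vs × y ∈ vs
Consecutive⇒∈ {vs = _ ∷ _ ∷ _} (inj₁ (refl , refl)) = here refl , there (here refl)
Consecutive⇒∈ {vs = _ ∷ _ ∷ _} (inj₂ c) = Product.map there there (Consecutive⇒∈ c)

PathEdge⇒∈ : ∀ {vs} → PathEdge vs x y → x ∈ vs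
PathEdge⇒∈ = Sum.[ proj₁ ∘ Consecutive⇒∈ , proj₂ ∘ Consecutive⇒∈ ]

∈⇒PathEdge : ∀ {vs} → v ∈ x ∷ y ∷ vs → ∃[ z ] PathEdge (x ∷ y ∷ vs) v z
∈⇒PathEdge {y = y} (here refl)              = y , inj₁ (inj₁ (refl , refl))
∈⇒PathEdge {x = x} (there (here refl))     = x , inj₂ (inj₁ (refl , refl))
∈⇒PathEdge {vs = _ ∷ _} (there (there v∈)) =
  Product.map₂ (Sum.map inj₂ inj₂) (∈⇒PathEdge (there v∈))

PathEdge-∷ : Joins q b e → PathEdge (b ∷ e ∷ rest) x y ⇔ (Joins q x y ⊎ PathEdge (e ∷ rest) x y)
PathEdge-∷ {q = q} {b} {e} {rest} {x} {y} be = mk⇔ ⇒ ⇐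
  where
  ⇒ : PathEdge (b ∷ e ∷ rest) x y → Joins q x y ⊎ PathEdge (e ∷ rest) x y
  ⇒ (inj₁ (inj₁ (refl , refl))) = inj₁ be
  ⇒ (inj₂ (inj₁ (refl , refl))) = inj₁ (Joins-sym be)
  ⇒ (inj₁ (inj₂ c))             = inj₂ (inj₁ c)
  ⇒ (inj₂ (inj₂ c))             = inj₂ (inj₂ c)
  ⇐ : Joins q x y ⊎ PathEdge (e ∷ rest) x y → PathEdge (b ∷ e ∷ rest) x y
  ⇐ (inj₁ xy) with Joins-unique be xy
  ... | inj₁ (refl , refl) = inj₁ (inj₁ (refl , refl))
  ... | inj₂ (refl , refl) = inj₂ (inj₁ (refl , refl))
  ⇐ (inj₂ edge) = Sum.map inj₂ inj₂ edge

SymDiff-self⇔trivialPath : ∀ v → SymDiff M M x y ⇔ PathEdge (v ∷ []) x y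
SymDiff-self⇔trivialPath _ = mk⇔ (⊥-elim ∘ SymDiff-self) λ { (inj₁ ()) ; (inj₂ ()) }

Alternating-map : (∀ {x y} → InM M₁ x y → InM M₁′ x y) →
                  (∀ {x y} → InM M₂ x y → InM M₂′ x y) →
                  ∀ vs → Alternating M₁ M₂ vs → Alternating M₁′ M₂′ vs
Alternating-map f g []                _ = tt
Alternating-map f g (_ ∷ [])          _ = tt
Alternating-map f g (_ ∷ _ ∷ [])      _ = tt
Alternating-map f g (_ ∷ y ∷ z ∷ vs) (steps , alt) =
  Sum.map (Product.map f g) (Product.map g f) steps , Alternating-map f g (y ∷ z ∷ vs) alt

Alternating-sym : ∀ vs → Alternating M₁ M₂ vs → Alternating M₂ M₁ vs
Alternating-sym []                _ = tt
Alternating-sym (_ ∷ [])          _ = tt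
Alternating-sym (_ ∷ _ ∷ [])      _ = tt
Alternating-sym (_ ∷ y ∷ z ∷ vs) (steps , alt) = Sum.swap steps , Alternating-sym (y ∷ z ∷ vs) alt

SymDiffIsAlternatingPath : List (Pair n) → List (Pair n) → Set
SymDiffIsAlternatingPath {n} M₁ M₂ = Σ (List (Fin n)) λ vs →
  Unique vs × (∀ x y → SymDiff M₁ M₂ x y ⇔ PathEdge vs x y) × Alternating M₁ M₂ vs

SymDiffIsAlternatingPath-sym : SymDiffIsAlternatingPath M₁ M₂ → SymDiffIsAlternatingPath M₂ M₁
SymDiffIsAlternatingPath-sym (vs , unique , diff⇔edge , alternating) =
  vs , unique , (λ x y → ⇔-trans SymDiff-comm (diff⇔edge x y)) , Alternating-sym vs alternating

module _ (u : Fin n) where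

  record DiffPath (M₁ M₂ : List (Pair n)) (e w : Fin n) (rest : List (Fin n)) : Set where
    field
      diff⇔edge    : ∀ x y → SymDiff M₁ M₂ x y ⇔ PathEdge (e ∷ w ∷ rest) x y
      unique       : Unique (e ∷ w ∷ rest)
      alternating  : Alternating M₁ M₂ (e ∷ w ∷ rest)
      front-edge   : InM M₁ e w
      front-free   : isCovered e M₂ ≡ false
      cover-agrees : ∀ v → v ≢ e → v ≢ u → isCovered v M₁ ≡ isCovered v M₂

  open DiffPath

  -- A path node other than e and u lies on an edge of M₁ or M₂, hence is covered on both sides.
  free⇒∉path : DiffPath M₁ M₂ e w rest → isCovered v M₁ ≡ false → v ≢ e → v ≢ u → v ∉ e ∷ w ∷ rest
  free⇒∉path {v = v} P free v≢e v≢u v∈ with ∈⇒PathEdge v∈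
  ... | z , edge with from (diff⇔edge P v z) edge
  ...   | inj₁ (in₁ , _) = free⇒¬InM free in₁
  ...   | inj₂ (in₂ , _) = free⇒¬InM (trans (sym (cover-agrees P v v≢e v≢u)) free) in₂

  start : isCovered b M ≡ false → b ≢ u → Joins q b u → DiffPath (q ∷ M) M b u []
  start {b = b} {M = M} {q = q} b-free b≢u bu = record
    { diff⇔edge    = diff⇔edge′
    ; unique       = (b≢u ∷ []) ∷ [] ∷ []
    ; alternating  = tt
    ; front-edge   = InM-here bu
    ; front-free   = b-free
    ; cover-agrees = λ v v≢b v≢u → Joins-isCovered {M = M} bu v≢b v≢u
    }
    where
    diff⇔edge′ : ∀ x y → SymDiff (q ∷ M) M x y ⇔ PathEdge (b ∷ u ∷ []) x y
    diff⇔edge′ x y = begin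
      SymDiff (q ∷ M) M x y                  ∼⟨ SymDiff-∷ (Joins-free⇒¬InM bu b-free) ⟩
      (Joins q x y ⊎ SymDiff M M x y)        ∼⟨ ⇔-refl ⊎-⇔ SymDiff-self⇔trivialPath u ⟩
      (Joins q x y ⊎ PathEdge (u ∷ []) x y)  ∼⟨ ⇔-sym (PathEdge-∷ {rest = []} bu) ⟩
      PathEdge (b ∷ u ∷ []) x y              ∎
      where open EquationalReasoning

  extend : DiffPath M₁ M₂ e w rest → Joins q b e → isCovered b M₂ ≡ false → b ≢ u → b ≢ e →
           DiffPath (q ∷ M₂) M₁ b e (w ∷ rest)
  extend {M₁ = M₁} {M₂} {e} {w} {rest} {q} {b} P be b-free₂ b≢u b≢e = record
    { diff⇔edge    = diff⇔edge′
    ; unique       = ¬Any⇒All¬ _ (free⇒∉path P b-free₁ b≢e b≢u) ∷ unique P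
    ; alternating  = inj₁ (InM-here be , front-edge P)
                   , Alternating-sym (e ∷ w ∷ rest)
                                     (Alternating-map id InM-there (e ∷ w ∷ rest) (alternating P))
    ; front-edge   = InM-here be
    ; front-free   = b-free₁
    ; cover-agrees = agrees
    }
    where
    b-free₁ : isCovered b M₁ ≡ false
    b-free₁ = trans (cover-agrees P b b≢e b≢u) b-free₂
    diff⇔edge′ : ∀ x y → SymDiff (q ∷ M₂) M₁ x y ⇔ PathEdge (b ∷ e ∷ w ∷ rest) x y
    diff⇔edge′ x y = begin
      SymDiff (q ∷ M₂) M₁ x y                      ∼⟨ SymDiff-∷ (Joins-free⇒¬InM be b-free₁) ⟩
      (Joins q x y ⊎ SymDiff M₂ M₁ x y)            ∼⟨ ⇔-refl ⊎-⇔ ⇔-trans SymDiff-comm (diff⇔edge P x y) ⟩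
      (Joins q x y ⊎ PathEdge (e ∷ w ∷ rest) x y)  ∼⟨ ⇔-sym (PathEdge-∷ be) ⟩
      PathEdge (b ∷ e ∷ w ∷ rest) x y              ∎
      where open EquationalReasoning
    agrees : ∀ v → v ≢ b → v ≢ u → isCovered v (q ∷ M₂) ≡ isCovered v M₁
    agrees v v≢b v≢u with v ≟ e
    ... | yes refl = trans (InM⇒isCovered (InM-here {M = M₂} (Joins-sym be)))
                           (sym (InM⇒isCovered (front-edge P)))
    ... | no v≢e   = trans (Joins-isCovered {M = M₂} be v≢b v≢e) (sym (cover-agrees P v v≢e v≢u))

  addBoth : DiffPath M₁ M₂ e w rest → isCovered a M₁ ≡ false → isCovered b M₁ ≡ false →
            a ≢ e → b ≢ e → a ≢ u → b ≢ u → DiffPath ((a , b) ∷ M₁) ((a , b) ∷ M₂) e w rest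
  addBoth {M₁ = M₁} {M₂} {e} {w} {rest} {a} {b} P a-free b-free a≢e b≢e a≢u b≢u = record
    { diff⇔edge    = λ x y → ⇔-trans (SymDiff-∷-∷ off-path) (diff⇔edge P x y)
    ; unique       = unique P
    ; alternating  = Alternating-map InM-there InM-there (e ∷ w ∷ rest) (alternating P)
    ; front-edge   = InM-there (front-edge P)
    ; front-free   = trans (isCovered-∷ {M = M₂} a≢e b≢e) (front-free P)
    ; cover-agrees = λ v v≢e v≢u → cong (λ c → (a == v) ∨ (b == v) ∨ c) (cover-agrees P v v≢e v≢u)
    }
    where
    off-path : Joins (a , b) x y → ¬ SymDiff M₁ M₂ x y
    off-path {x} {y} xy d with Joins⇒endpoint xy | PathEdge⇒∈ (to (diff⇔edge P x y) d)
    ... | inj₁ refl | x∈ = free⇒∉path P a-free a≢e a≢u x∈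
    ... | inj₂ refl | x∈ = free⇒∉path P b-free b≢e b≢u x∈

  DiffIsPath : List (Pair n) → List (Pair n) → Set
  DiffIsPath M₁ M₂ = ∃[ e ] ∃[ w ] ∃[ rest ] (DiffPath M₁ M₂ e w rest ⊎ DiffPath M₂ M₁ e w rest)

  DiffIsPath-sym : DiffIsPath M₁ M₂ → DiffIsPath M₂ M₁
  DiffIsPath-sym (e , w , rest , P) = e , w , rest , Sum.swap P

  data Coupled : List (Pair n) → List (Pair n) → Set where
    identical : isCovered u M ≡ false → Coupled M M
    diverged  : DiffIsPath M₁ M₂ → isCovered u M₁ ≡ true → isCovered u M₂ ≡ false → Coupled M₁ M₂

  DiffIsPath⇒SymDiffIsAlternatingPath : DiffIsPath M₁ M₂ → SymDiffIsAlternatingPath M₁ M₂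
  DiffIsPath⇒SymDiffIsAlternatingPath (_ , _ , _ , inj₁ P) = _ , unique P , diff⇔edge P , alternating P
  DiffIsPath⇒SymDiffIsAlternatingPath (_ , _ , _ , inj₂ P) =
    SymDiffIsAlternatingPath-sym (_ , unique P , diff⇔edge P , alternating P)

  DiffIsPath⇒nonempty : DiffIsPath M₁ M₂ → ∃[ x ] ∃[ y ] SymDiff M₁ M₂ x y
  DiffIsPath⇒nonempty (e , w , _ , inj₁ P) = e , w , inj₁ (front-edge P , free⇒¬InM (front-free P))
  DiffIsPath⇒nonempty (e , w , _ , inj₂ P) = e , w , inj₂ (front-edge P , free⇒¬InM (front-free P))

  Coupled⇒SymDiffIsAlternatingPath : Coupled M₁ M₂ → SymDiffIsAlternatingPath M₁ M₂
  Coupled⇒SymDiffIsAlternatingPath (identical _) =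
    u ∷ [] , [] ∷ [] , (λ x y → SymDiff-self⇔trivialPath u) , tt
  Coupled⇒SymDiffIsAlternatingPath (diverged D _ _) = DiffIsPath⇒SymDiffIsAlternatingPath D

  Coupled⇒nonempty⇔Matched : Coupled M₁ M₂ → (∃[ x ] ∃[ y ] SymDiff M₁ M₂ x y) ⇔ Matched u M₁
  Coupled⇒nonempty⇔Matched (identical u-free) =
    mk⇔ (λ (_ , _ , d) → ⊥-elim (SymDiff-self d))
        (λ m → contradiction (trans (sym (Matched⇒isCovered m)) u-free) λ ())
  Coupled⇒nonempty⇔Matched (diverged {M₁} D u-covered _) =
    mk⇔ (λ _ → isCovered⇒Matched M₁ u-covered) (λ _ → DiffIsPath⇒nonempty D)

module _ (G : Graph n) where

  canMatch : List (Pair n) → Pair n → Bool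
  canMatch M (a , b) = not (isCovered a M) ∧ not (isCovered b M) ∧ adj G a b

  data StepView (M : List (Pair n)) (p : Pair n) : List (Pair n) → Set where
    added   : canMatch M p ≡ true  → StepView M p (p ∷ M)
    skipped : canMatch M p ≡ false → StepView M p M

  stepView : ∀ M p → StepView M p (probeStep G M p)
  stepView M (a , b) = view (canMatch M (a , b)) refl
    where
    view : ∀ c → canMatch M (a , b) ≡ c → StepView M (a , b) (if c then (a , b) ∷ M else M)
    view true  eq = added eq
    view false eq = skipped eq

  probeStep-added : ∀ M → canMatch M p ≡ true → probeStep G M p ≡ p ∷ M
  probeStep-added {p = a , b} M = cong (λ c → if c then (a , b) ∷ M else M)

  probeStep-skipped : ∀ M → canMatch M p ≡ false → probeStep G M p ≡ M
  probeStep-skipped {p = a , b} M = cong (λ c → if c then (a , b) ∷ M else M)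

  canMatch⇒free : ∀ M → canMatch M p ≡ true → Joins p x y → isCovered x M ≡ false
  canMatch⇒free M m (inj₁ refl) = not-injective (∧-conicalˡ _ _ m)
  canMatch⇒free {y = y} M m (inj₂ refl) =
    not-injective (∧-conicalˡ _ _ (∧-conicalʳ (not (isCovered y M)) _ m))

  covered⇒¬canMatch : ∀ M → isCovered x M ≡ true → Joins p x y → canMatch M p ≡ false
  covered⇒¬canMatch M x-covered (inj₁ refl) rewrite x-covered = refl
  covered⇒¬canMatch {y = y} M x-covered (inj₂ refl) rewrite x-covered = ∧-zeroʳ (not (isCovered y M))

  canMatch-cong : ∀ M₁ M₂ → isCovered a M₁ ≡ isCovered a M₂ → isCovered b M₁ ≡ isCovered b M₂ →
                  canMatch M₁ (a , b) ≡ canMatch M₂ (a , b)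
  canMatch-cong {a = a} {b = b} _ _ = cong₂ (λ c d → not c ∧ not d ∧ adj G a b)

  isCovered-probeStep : ∀ M → a ≢ v → b ≢ v → isCovered v (probeStep G M (a , b)) ≡ isCovered v M
  isCovered-probeStep {a = a} {b = b} M a≢v b≢v with probeStep G M (a , b) | stepView M (a , b)
  ... | _ | added _   = isCovered-∷ {M = M} a≢v b≢v
  ... | _ | skipped _ = refl

  module _ (u : Fin n) where

    frontStep : DiffPath u M₁ M₂ e w rest → Joins p b e → b ≢ u → b ≢ e →
                DiffIsPath u (probeStep G M₁ p) (probeStep G M₂ p)
    frontStep {M₁ = M₁} {M₂} {p = p} P be b≢u b≢e
      rewrite probeStep-skipped M₁
                (covered⇒¬canMatch M₁ (InM⇒isCovered (DiffPath.front-edge P)) (Joins-sym be))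
      with probeStep G M₂ p | stepView M₂ p
    ... | _ | skipped _ = _ , _ , _ , inj₁ P
    ... | _ | added m₂  = _ , _ , _ , inj₂ (extend u P be (canMatch⇒free M₂ m₂ be) b≢u b≢e)

    offFrontStep : DiffPath u M₁ M₂ e w rest → a ≢ e → b ≢ e → a ≢ u → b ≢ u →
                   DiffIsPath u (probeStep G M₁ (a , b)) (probeStep G M₂ (a , b))
    offFrontStep {M₁ = M₁} {M₂} {a = a} {b} P a≢e b≢e a≢u b≢u
      with same ← canMatch-cong M₁ M₂ (DiffPath.cover-agrees P a a≢e a≢u)
                                      (DiffPath.cover-agrees P b b≢e b≢u)
      with probeStep G M₁ (a , b) | stepView M₁ (a , b)
    ... | _ | skipped s₁ rewrite probeStep-skipped M₂ (trans (sym same) s₁) = _ , _ , _ , inj₁ P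
    ... | _ | added m₁   rewrite probeStep-added M₂ (trans (sym same) m₁) =
      _ , _ , _ , inj₁ (addBoth u P (canMatch⇒free M₁ m₁ (inj₁ refl))
                                    (canMatch⇒free M₁ m₁ (inj₂ refl)) a≢e b≢e a≢u b≢u)

    pathStep : DiffPath u M₁ M₂ e w rest → a ≢ u → b ≢ u → a ≢ b →
               DiffIsPath u (probeStep G M₁ (a , b)) (probeStep G M₂ (a , b))
    pathStep {e = e} {a = a} {b = b} P a≢u b≢u a≢b with a ≟ e | b ≟ e
    ... | yes refl | _        = frontStep P (inj₂ refl) b≢u (a≢b ∘ sym)
    ... | no a≢e   | yes refl = frontStep P (inj₁ refl) a≢u a≢e
    ... | no a≢e   | no b≢e   = offFrontStep P a≢e b≢e a≢u b≢u

    DiffIsPath-step : DiffIsPath u M₁ M₂ → a ≢ u → b ≢ u → a ≢ b →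
                      DiffIsPath u (probeStep G M₁ (a , b)) (probeStep G M₂ (a , b))
    DiffIsPath-step (_ , _ , _ , inj₁ P) a≢u b≢u a≢b = pathStep P a≢u b≢u a≢b
    DiffIsPath-step (_ , _ , _ , inj₂ P) a≢u b≢u a≢b = DiffIsPath-sym u (pathStep P a≢u b≢u a≢b)

    Coupled-step : a ≢ u → b ≢ u → a ≢ b → Coupled u M₁ M₂ →
                   Coupled u (probeStep G M₁ (a , b)) (probeStep G M₂ (a , b))
    Coupled-step a≢u b≢u a≢b (identical {M} u-free) =
      identical (trans (isCovered-probeStep M a≢u b≢u) u-free)
    Coupled-step a≢u b≢u a≢b (diverged {M₁} {M₂} D u-covered₁ u-free₂) =
      diverged (DiffIsPath-step D a≢u b≢u a≢b)
               (trans (isCovered-probeStep M₁ a≢u b≢u) u-covered₁)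
               (trans (isCovered-probeStep M₂ a≢u b≢u) u-free₂)

    Coupled-step-u : Joins p u b → b ≢ u → Coupled u M₁ M₂ → Coupled u (probeStep G M₁ p) M₂
    Coupled-step-u {p = p} ub b≢u (identical {M} u-free) with probeStep G M p | stepView M p
    ... | _ | skipped _ = identical u-free
    ... | _ | added m   =
      diverged (_ , _ , _ , inj₁ (start u (canMatch⇒free M m (Joins-sym ub)) b≢u (Joins-sym ub)))
               (InM⇒isCovered (InM-here {M = M} ub)) u-free
    Coupled-step-u ub b≢u (diverged {M₁} D u-covered₁ u-free₂)
      rewrite probeStep-skipped M₁ (covered⇒¬canMatch M₁ u-covered₁ ub) = diverged D u-covered₁ u-free₂

    Coupled-probeFrom : ∀ L → (∀ {p} → p ∈ L → proj₁ p ≢ proj₂ p) → Coupled u M₁ M₂ →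
                        Coupled u (probeFrom G M₁ L) (probeFrom G M₂ (removeNode u L))
    Coupled-probeFrom [] _ C = C
    Coupled-probeFrom ((a , b) ∷ L) distinct C with a ≟ u | b ≟ u
    ... | yes refl | _        =
      Coupled-probeFrom L (distinct ∘ there) (Coupled-step-u (inj₁ refl) (distinct (here refl) ∘ sym) C)
    ... | no a≢u   | yes refl =
      Coupled-probeFrom L (distinct ∘ there) (Coupled-step-u (inj₂ refl) a≢u C)
    ... | no a≢u   | no b≢u   =
      Coupled-probeFrom L (distinct ∘ there) (Coupled-step a≢u b≢u (distinct (here refl)) C)

-- Only the distinctness of the entries of L is used.
lemma1 : ∀ {n : ℕ} (G : Graph n) (L : List (Pair n)) (u : Fin n) →
    IsProbingList L →
    (Σ (List (Fin n)) λ vs →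
        Unique vs
        × (∀ x y → SymDiff (probe G L) (probe G (removeNode u L)) x y
                   ⇔ (Consecutive vs x y ⊎ Consecutive vs y x))
        × Alternating (probe G L) (probe G (removeNode u L)) vs)
    × ((∃ λ x → ∃ λ y → SymDiff (probe G L) (probe G (removeNode u L)) x y)
       ⇔ Matched u (probe G L))
lemma1 G L u (distinct , _) =
  Coupled⇒SymDiffIsAlternatingPath u coupled , Coupled⇒nonempty⇔Matched u coupled
  where
  coupled : Coupled u (probe G L) (probe G (removeNode u L))
  coupled = Coupled-probeFrom G u L distinct (identical refl)
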